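{- Let $\langle P,\le^P\rangle$ and $\langle Q,\le^Q\rangle$ be partially ordered sets. If $(f,g)$ is a Chu transform from $\langle P,\le^P,P\rangle$ to $\langle Q,\le^Q,Q\rangle$, then $(f,g)$ is dense.
   Context: A Chu space is a triple $\langle X,r,A\rangle$ with $r\subseteq X\times A$; a partially ordered set $\langle P,\le^P\rangle$ is regarded as the Chu space $\langle P,\le^P,P\rangle$ (points and states both $P$, relation $\le^P$). A Chu transform from $\langle X,r,A\rangle$ to $\langle Y,s,B\rangle$ is a pair $f\colon X\to Y$, $g\colon B\to A$ with $\langle x,g(b)\rangle\in r\iff\langle f(x),b\rangle\in s$ for all $x\in X$, $b\in B$; it is dense if for every $b\in B$, if some $y\in Y$ has $\langle y,b\rangle\in s$, then some $x\in X$ has $\langle f(x),b\rangle\in s$. -}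

module Defs where

open import Level using (Level; _⊔_; suc)
open import Data.Product using (Σ; _×_; ∃-syntax)
open import Function.Bundles using (_⇔_)
open import Relation.Binary.Bundles using (Poset)

record ChuSpace (x a ℓ : Level) : Set (Level.suc (x ⊔ a ⊔ ℓ)) where
  field
    Pts : Set x
    Sts : Set a
    rel : Pts → Sts → Set ℓ

open ChuSpace public

posetChu : ∀ {c ℓ₁ ℓ₂} → Poset c ℓ₁ ℓ₂ → ChuSpace c c ℓ₂
posetChu P = record { Pts = Poset.Carrier P ; Sts = Poset.Carrier P ; rel = Poset._≤_ P }

IsChuTransform : ∀ {x a ℓ y b m} (C : ChuSpace x a ℓ) (D : ChuSpace y b m)
  → (Pts C → Pts D) → (Sts D → Sts C) → Set (x ⊔ b ⊔ ℓ ⊔ m)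
IsChuTransform C D f g = ∀ p q → rel C p (g q) ⇔ rel D (f p) q

IsDense : ∀ {x a ℓ y b m} (C : ChuSpace x a ℓ) (D : ChuSpace y b m)
  → (Pts C → Pts D) → (Sts D → Sts C) → Set (x ⊔ y ⊔ b ⊔ m)
IsDense C D f g = ∀ q → (∃[ y ] rel D y q) → ∃[ p ] rel D (f p) q

{-# OPTIONS --safe #-}
module Submission where

open import Defs
open import Relation.Binary.Bundles using (Poset)
open import Function.Bundles using (Equivalence)
open import Data.Product using (_,_; ∃-syntax)

-- The hypothesis that q is satisfied in D is deliberately unused: f sends any
-- point satisfying g q to one satisfying q.
isChuTransform⇒isDense : ∀ {x a ℓ y b m} (C : ChuSpace x a ℓ) (D : ChuSpace y b m)
  (f : Pts C → Pts D) (g : Sts D → Sts C)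
  → (∀ s → ∃[ p ] rel C p s)
  → IsChuTransform C D f g
  → IsDense C D f g
isChuTransform⇒isDense C D f g satisfiable T q _ with satisfiable (g q)
... | p , p⊨gq = p , Equivalence.to (T p q) p⊨gq

corollary5p2 : ∀ {c ℓ₁ ℓ₂ d m₁ m₂} (P : Poset c ℓ₁ ℓ₂) (Q : Poset d m₁ m₂)
    (f : Poset.Carrier P → Poset.Carrier Q) (g : Poset.Carrier Q → Poset.Carrier P)
    → IsChuTransform (posetChu P) (posetChu Q) f g
    → IsDense (posetChu P) (posetChu Q) f g
corollary5p2 P Q f g =
  isChuTransform⇒isDense (posetChu P) (posetChu Q) f g (λ s → s , Poset.refl P)
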